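{- There are infinitely many SP numbers of the form $x^2+1$ with $x\in\mathbb{N}$.
   Context: An SP number (square-prime number) is a natural number of the form $p\cdot a^2$ where $p$ is a prime and $a\geq 2$ is a natural number (i.e. $a\neq 1$). -}

module Defs where

open import Data.Nat using (ℕ; _*_; _≥_)
open import Data.Nat.Primality using (Prime)
open import Data.Product using (Σ; _×_)
open import Relation.Binary.PropositionalEquality using (_≡_)

IsSP : ℕ → Set
IsSP n = Σ ℕ λ p → Σ ℕ λ a → Prime p × a ≥ 2 × n ≡ p * (a * a)

module Submission where

-- Every solution of the negative Pell equation x² + 1 = 2y² exhibits x² + 1 = 2 · y² as an
-- SP number as soon as y ≥ 2. Starting from (1, 1), the map (x, y) ↦ (3x + 4y, 2x + 3y),
-- multiplication of x + y√2 by the unit 3 + 2√2, preserves the equation and strictly increases y,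
-- so there are solutions with y, and hence x² + 1, as large as we like.

open import Defs
open import Data.Nat using (ℕ; zero; suc; _+_; _*_; _≤_; _<_; _≥_; s≤s; z≤n)
open import Data.Nat.Properties
  using (≤-trans; m≤m+n; m≤n+m; m<m+n; m≤m*n; m+n≡0⇒n≡0; +-cancelʳ-≡)
open import Data.Nat.Primality using (prime[2])
open import Data.Nat.Tactic.RingSolver using (solve-∀)
open import Data.Product using (Σ; _×_; _,_)
open import Relation.Binary.PropositionalEquality using (_≡_; refl; cong; sym; subst; module ≡-Reasoning)

n≤n*n : ∀ n → n ≤ n * n
n≤n*n zero    = z≤n
n≤n*n (suc n) = m≤m*n (suc n) (suc n)

record NegPellSolution : Set where
  constructor negPell
  field
    x y      : ℕ
    x²+1≡2y² : x * x + 1 ≡ 2 * (y * y)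

open NegPellSolution

-- The preservation identity (3x+4y)² − 2(2x+3y)² = x² − 2y², with both sides moved so
-- that no subtraction occurs.
unit-identity : ∀ x y →
  (3 * x + 4 * y) * (3 * x + 4 * y) + 1 + 2 * (y * y) ≡ 2 * ((2 * x + 3 * y) * (2 * x + 3 * y)) + (x * x + 1)
unit-identity = solve-∀

next : NegPellSolution → NegPellSolution
next (negPell x y x²+1≡2y²) = negPell x′ y′ (+-cancelʳ-≡ (2 * (y * y)) _ _ (begin
    x′ * x′ + 1 + 2 * (y * y)     ≡⟨ unit-identity x y ⟩
    2 * (y′ * y′) + (x * x + 1)   ≡⟨ cong (2 * (y′ * y′) +_) x²+1≡2y² ⟩
    2 * (y′ * y′) + 2 * (y * y)   ∎))
  where
  open ≡-Reasoning
  x′ y′ : ℕ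
  x′ = 3 * x + 4 * y
  y′ = 2 * x + 3 * y

1≤y : ∀ s → 1 ≤ y s
1≤y (negPell x zero    eq) with () ← m+n≡0⇒n≡0 (x * x) eq
1≤y (negPell x (suc y) eq) = s≤s z≤n

y<y-next : ∀ s → y s < y (next s)
y<y-next s@(negPell x y _) = ≤-trans (m<m+n y (≤-trans (1≤y s) (m≤m+n y _))) (m≤n+m (3 * y) (2 * x))

solution : ℕ → NegPellSolution
solution zero    = negPell 1 1 refl
solution (suc k) = next (solution k)

k<y-solution : ∀ k → k < y (solution k)
k<y-solution zero    = 1≤y (solution zero)
k<y-solution (suc k) = ≤-trans (s≤s (k<y-solution k)) (y<y-next (solution k))

y≤x²+1 : ∀ s → y s ≤ x s * x s + 1
y≤x²+1 (negPell x y x²+1≡2y²) =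
  subst (y ≤_) (sym x²+1≡2y²) (≤-trans (n≤n*n y) (m≤m+n (y * y) (y * y + 0)))

x²+1-isSP : ∀ s → 2 ≤ y s → IsSP (x s * x s + 1)
x²+1-isSP (negPell x y x²+1≡2y²) 2≤y = 2 , y , prime[2] , 2≤y , x²+1≡2y²

theorem2p2 : (N : ℕ) → Σ ℕ λ n → n ≥ N × IsSP n × Σ ℕ λ x → n ≡ x * x + 1
theorem2p2 N = x s * x s + 1 , N≤x²+1 , x²+1-isSP s 2≤y , x s , refl
  where
  s : NegPellSolution
  s = solution (suc N)

  N+2≤y : suc (suc N) ≤ y s
  N+2≤y = k<y-solution (suc N)

  2≤y : 2 ≤ y s
  2≤y = ≤-trans (s≤s (s≤s z≤n)) N+2≤y

  N≤x²+1 : N ≤ x s * x s + 1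
  N≤x²+1 = ≤-trans (m≤n+m N 2) (≤-trans N+2≤y (y≤x²+1 s))
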